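{- Let $n\ge 1$ and let $\sigma\in D_n\cup E_n$ with $\sigma\neq\pi_n$. If $\sigma\in D_n$, then $\lambda_n(\sigma)\in E_n$. If $\sigma\in E_n$, then $\lambda_n(\sigma)\in D_n$. Moreover, $\lambda_n(\lambda_n(\sigma))=\sigma$.
   Context: For $n \geq 0$ let $\mathfrak{S}_n$ be the set of permutations of $[n]=\{1,\dots,n\}$ ($\mathfrak{S}_0$ consists of the empty permutation $()$), written in disjoint cycle notation. Let $D_n\subseteq \mathfrak{S}_n$ be the set of derangements (permutations with no fixed point) and $E_n \subseteq \mathfrak{S}_n$ the set of permutations with exactly one fixed point. Define $\pi_n = (1\,2)(3\,4)\cdots(n-1\;n)$ if $n$ is even and $\pi_n=(1\,2)(3\,4)\cdots(n-2\;\,n-1)(n)$ if $n$ is odd; so $\pi_0=()$, $\pi_1=(1)$, $\pi_n\in D_n$ for $n$ even and $\pi_n \in E_n$ for $n$ odd. Let $\Pi_n=\{\pi_n\}$. For $\sigma\in\mathfrak{S}_n$ and $a\in[n]$, $\sigma\setminus a$ denotes the permutation of $[n]\setminus\{a\}$ obtained by deleting $a$ from the disjoint cycle decomposition of $\sigma$: $(\sigma\setminus a)(x)=\sigma(x)$ if $\sigma(x)\neq a$, and $(\sigma\setminus a)(\sigma^{ -1}(a))=\sigma(a)$ if $\sigma(a)\ne a$ (if $a$ is a fixed point, it is simply removed). For $n\ge 1$ define the bijection $f_n:[n]\times D_{n-1}\to E_n$ by: for $m<n$, $f_n(m,\sigma)$ is the permutation $\tau$ of $[n]$ obtained by replacing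 $m$ by $n$ in the cycle decomposition of $\sigma$ and adding the fixed point $m$ (i.e. $\tau(m)=m$, $\tau(\sigma^{ -1}(m))=n$, $\tau(n)=\sigma(m)$, $\tau(x)=\sigma(x)$ otherwise); and $f_n(n,\sigma)$ is $\sigma$ with the fixed point $n$ appended. Define bijections $\alpha_n$ recursively: for $n$ even, $\alpha_n: D_n\to E_n\sqcup \Pi_n$; for $n$ odd, $\alpha_n: D_n\sqcup\Pi_n\to E_n$ (these unions are disjoint). Let $\alpha_0$ send $()$ to $\pi_0$ and $\alpha_1$ send $\pi_1$ to $(1)$. For $n\ge 2$ and $\sigma$ in the domain of $\alpha_n$, with $\alpha_{n-1}^{ -1}$ the inverse of the bijection $\alpha_{n-1}$: (i) if $\sigma\in D_n$ and $n$ lies in a cycle of $\sigma$ of length at least $3$, then $\alpha_n(\sigma)=f_n(\sigma(n),\sigma\setminus n)$; (ii) if $\sigma\in D_n$ and $n$ lies in a $2$-cycle of $\sigma$, then $\sigma\setminus n\in E_{n-1}$; let $\rho=\alpha_{n-1}^{ -1}(\sigma\setminus n)$. If $\rho\in D_{n-1}$, then $\alpha_n(\sigma)=f_n(n,\rho)$; if $\rho=\pi_{n-1}\in\Pi_{n-1}$ (possible only for $n$ even), then $\alpha_n(\sigma)=\pi_n\in\Pi_n$; (iii) if $n$ is odd and $\sigma=\pi_n\in\Pi_n$, then $\alpha_n(\pi_n)=f_n\big(n,\alpha_{n-1}^{ -1}(\pi_{n-1})\big)$, where $\pi_{n-1}$ is regarded as the element of $\Pi_{n-1}$ in the domain of $\alpha_{n-1}^{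 -1}$. Define $\gamma_n:E_n\to D_{n+1}$ by sending $\sigma$ with unique fixed point $m$ to the permutation of $[n+1]$ that agrees with $\sigma$ on $[n]\setminus\{m\}$ and interchanges $m$ and $n+1$. Define $\lambda_n: D_n\cup E_n\to D_n\cup E_n$ by $\lambda_n(\sigma)=\alpha_n(\sigma)$ if $\sigma\in D_n$, and $\lambda_n(\sigma)=\alpha_{n+1}(\gamma_n(\sigma))\setminus(n+1)$ if $\sigma\in E_n$ (elements of $\Pi_k$ being regarded as the permutation $\pi_k$). -}

module Defs where

open import Data.Nat using (ℕ; zero; suc)
open import Data.Nat.Divisibility using (_∣_)
open import Data.Fin using (Fin; zero; suc; fromℕ; inject₁; _≟_)
open import Data.Vec using (Vec; []; _∷_; lookup; tabulate; map)
open import Data.Maybe using (Maybe; just; nothing)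
import Data.Maybe as Maybe
open import Data.Product using (Σ; ∃; _×_; _,_)
open import Relation.Binary.PropositionalEquality using (_≡_; _≢_)
open import Relation.Nullary using (¬_; yes; no)

-- Conventions: [n] = {1,...,n} is represented by Fin n (0-indexed, so
-- the element i of [n] is the Fin value i-1, and n itself is  fromℕ k
-- when n = suc k).  A (candidate) permutation of [n] is the vector of its
-- values  σ(0), ..., σ(n-1).

Perm : ℕ → Set
Perm n = Vec (Fin n) n

IsPerm : ∀ {n} → Perm n → Set
IsPerm {n} σ = ∀ (x y : Fin n) → lookup σ x ≡ lookup σ y → x ≡ y

InD : ∀ {n} → Perm n → Set
InD {n} σ = IsPerm σ × (∀ (x : Fin n) → lookup σ x ≢ x)

InE : ∀ {n} → Perm n → Set
InE {n} σ = IsPerm σ × Σ (Fin n) (λ m → lookup σ m ≡ m × (∀ (x : Fin n) → lookup σ x ≡ x → x ≡ m))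

π : (n : ℕ) → Perm n
π zero = []
π (suc zero) = zero ∷ []
π (suc (suc n)) = suc zero ∷ zero ∷ map (λ j → suc (suc j)) (π n)

-- nothing for the largest element  fromℕ k ; just i for  inject₁ i
initLast : ∀ {k} → Fin (suc k) → Maybe (Fin k)
initLast {zero} zero = nothing
initLast {suc k} zero = just zero
initLast {suc k} (suc i) = Maybe.map suc (initLast i)

-- σ ∖ n : delete the largest element n = suc k from the cycle decomposition.
-- (The final default value x is never used when σ is a permutation.)
del : ∀ {k} → Perm (suc k) → Perm k
del {k} σ = tabulate val
  where
  val : Fin k → Fin k
  val x with initLast (lookup σ (inject₁ x))
  ... | just v = v
  ... | nothing with initLast (lookup σ (fromℕ k))
  ...   | just w = w
  ...   | nothing = x

f : ∀ k → Fin (suc k) → Perm k → Perm (suc k)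
f k m σ = tabulate val
  where
  val : Fin (suc k) → Fin (suc k)
  val y with initLast m | initLast y
  ... | nothing | nothing = fromℕ k
  ... | nothing | just y' = inject₁ (lookup σ y')
  ... | just m' | nothing = inject₁ (lookup σ m')
  ... | just m' | just y' with y' ≟ m'
  ...   | yes _ = inject₁ m'
  ...   | no _ with lookup σ y' ≟ m'
  ...     | yes _ = fromℕ k
  ...     | no _ = inject₁ (lookup σ y')

-- γ_k : E_k → D_{k+1}, given the (unique) fixed point m of σ
γ : ∀ k → Fin k → Perm k → Perm (suc k)
γ k m σ = tabulate val
  where
  val : Fin (suc k) → Fin (suc k)
  val y with initLast y
  ... | nothing = inject₁ m
  ... | just y' with y' ≟ m
  ...   | yes _ = fromℕ k
  ...   | no _ = inject₁ (lookup σ y')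

-- The graph of α_n:  Alpha n σ τ  means  α_n(σ) = τ  (elements of Π_n
-- regarded as π_n).  α_{n-1}^{-1}(τ) = ρ is expressed as  Alpha (n-1) ρ τ.
data Alpha : (n : ℕ) → Perm n → Perm n → Set where
  α0 : Alpha 0 [] []
  α1 : Alpha 1 (π 1) (zero ∷ [])
  αi : ∀ {k} (σ : Perm (suc (suc k))) → InD σ →
       lookup σ (lookup σ (fromℕ (suc k))) ≢ fromℕ (suc k) →
       Alpha (suc (suc k)) σ (f (suc k) (lookup σ (fromℕ (suc k))) (del σ))
  αiiD : ∀ {k} (σ : Perm (suc (suc k))) (ρ : Perm (suc k)) → InD σ →
         lookup σ (lookup σ (fromℕ (suc k))) ≡ fromℕ (suc k) →
         Alpha (suc k) ρ (del σ) → InD ρ →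
         Alpha (suc (suc k)) σ (f (suc k) (fromℕ (suc k)) ρ)
  αiiΠ : ∀ {k} (σ : Perm (suc (suc k))) → InD σ →
         lookup σ (lookup σ (fromℕ (suc k))) ≡ fromℕ (suc k) →
         2 ∣ suc (suc k) →
         Alpha (suc k) (π (suc k)) (del σ) →
         Alpha (suc (suc k)) σ (π (suc (suc k)))
  αiii : ∀ {k} (ρ : Perm (suc k)) → ¬ (2 ∣ suc (suc k)) →
         Alpha (suc k) ρ (π (suc k)) →
         Alpha (suc (suc k)) (π (suc (suc k))) (f (suc k) (fromℕ (suc k)) ρ)

data Lam : (n : ℕ) → Perm n → Perm n → Set where
  λD : ∀ {n} (σ τ : Perm n) → InD σ → Alpha n σ τ → Lam n σ τ
  λE : ∀ {n} (σ : Perm n) (m : Fin n) (ρ : Perm (suc n)) → InE σ →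
       lookup σ m ≡ m → Alpha (suc n) (γ n m σ) ρ → Lam n σ (del ρ)

{-# OPTIONS --safe #-}
-- α_n is a bijection from D_n ⊔ Π_n to E_n ⊔ Π_n (Π_n sitting on the side dictated by the parity of n);
-- functionality, injectivity, totality and surjectivity of its graph are proved by one simultaneous
-- induction, the key facts being that f_n(m, ρ) is f_n(n, ρ) conjugated by (m n) and that σ ∖ n
-- remembers σ(n) when n lies in a 2-cycle.  For σ ∈ D_n ∖ Π_n, τ = α_n(σ) lies in E_n; if m is its
-- fixed point, γ_n(τ) is a derangement with n+1 in the 2-cycle (m n+1) and γ_n(τ) ∖ (n+1) = τ, so
-- case (ii) gives α_{n+1}(γ_n τ) = f_{n+1}(n+1, σ), and deleting n+1 returns σ: λ_n(τ) = σ.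
-- Conversely, for σ ∈ E_n ∖ Π_n the same shape of γ_n(σ) forces α_{n+1}(γ_n σ) to come from case (ii)
-- with ρ = α_n⁻¹(σ) ∈ D_n, so λ_n(σ) = ρ and λ_n(ρ) = α_n(ρ) = σ.
module Submission where

open import Defs
open import Data.Nat using (ℕ; zero; suc; _≥_)
open import Data.Nat.Divisibility using (_∣_; _∤_; _∣?_; _∣0; ∣-refl; ∣1⇒≡1; ∣m+n∣m⇒∣n; ∣m∣n⇒∣m+n)
open import Data.Fin using (Fin; zero; suc; fromℕ; inject₁; _≟_)
open import Data.Fin.Properties using (inject₁-injective; fromℕ≢inject₁; suc-injective)
open import Data.Vec using ([]; _∷_; lookup; tabulate; map)
open import Data.Vec.Properties using (lookup∘tabulate; lookup-map)
open import Data.Vec.Relation.Binary.Pointwise.Extensional using (ext; Pointwise-≡⇒≡)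
open import Data.Maybe using (just; nothing)
open import Data.Product using (∃; _×_; _,_; proj₁; proj₂)
open import Data.Sum using (_⊎_; inj₁; inj₂)
open import Data.Empty using (⊥-elim)
open import Function using (_∘_; _∋_)
open import Relation.Nullary using (¬_; Dec; yes; no; contradiction)
open import Relation.Nullary.Decidable using (dec-true; dec-false)
open import Data.Fin.Permutation.Components using (transpose)
open import Relation.Binary.PropositionalEquality

inject₁≢fromℕ : ∀ {k} {i : Fin k} → inject₁ i ≢ fromℕ k
inject₁≢fromℕ = fromℕ≢inject₁ ∘ sym

initLast-inject₁ : ∀ {k} (i : Fin k) → initLast (inject₁ i) ≡ just i
initLast-inject₁ {suc k} zero = refl
initLast-inject₁ {suc k} (suc i) rewrite initLast-inject₁ i = refl

initLast-fromℕ : ∀ k → initLast (fromℕ k) ≡ nothing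
initLast-fromℕ zero = refl
initLast-fromℕ (suc k) rewrite initLast-fromℕ k = refl

fromℕ-or-inject₁ : ∀ {k} (y : Fin (suc k)) → y ≡ fromℕ k ⊎ ∃ λ i → y ≡ inject₁ i
fromℕ-or-inject₁ {zero} zero = inj₁ refl
fromℕ-or-inject₁ {suc k} zero = inj₂ (zero , refl)
fromℕ-or-inject₁ {suc k} (suc y) with fromℕ-or-inject₁ y
... | inj₁ eq = inj₁ (cong suc eq)
... | inj₂ (i , eq) = inj₂ (suc i , cong suc eq)

≢fromℕ⇒inject₁ : ∀ {k} {y : Fin (suc k)} → y ≢ fromℕ k → ∃ λ i → y ≡ inject₁ i
≢fromℕ⇒inject₁ {y = y} y≢n with fromℕ-or-inject₁ y
... | inj₁ eq = contradiction eq y≢n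
... | inj₂ i = i

lookup-≗ : ∀ {n} {σ τ : Perm n} → σ ≡ τ → ∀ i → lookup σ i ≡ lookup τ i
lookup-≗ refl i = refl

perm-ext : ∀ {n} {σ τ : Perm n} → (∀ i → lookup σ i ≡ lookup τ i) → σ ≡ τ
perm-ext = Pointwise-≡⇒≡ ∘ ext

transpose-ˡ : ∀ {n} (i j : Fin n) → transpose i j i ≡ j
transpose-ˡ i j rewrite dec-true (i ≟ i) refl = refl

transpose-ʳ : ∀ {n} {i j : Fin n} → j ≢ i → transpose i j j ≡ i
transpose-ʳ {i = i} {j} j≢i rewrite dec-false (j ≟ i) j≢i | dec-true (j ≟ j) refl = refl

transpose-other : ∀ {n} {i j k : Fin n} → k ≢ i → k ≢ j → transpose i j k ≡ k
transpose-other {i = i} {j} {k} k≢i k≢j rewrite dec-false (k ≟ i) k≢i | dec-false (k ≟ j) k≢j = refl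

transpose-involutive : ∀ {n} {i j : Fin n} → j ≢ i → ∀ k → transpose i j (transpose i j k) ≡ k
transpose-involutive {i = i} {j} j≢i k = by-cases (k ≟ i) (k ≟ j)
  where
  by-cases : Dec (k ≡ i) → Dec (k ≡ j) → transpose i j (transpose i j k) ≡ k
  by-cases (yes refl) _ = trans (cong (transpose i j) (transpose-ˡ i j)) (transpose-ʳ j≢i)
  by-cases (no _) (yes refl) = trans (cong (transpose i j) (transpose-ʳ j≢i)) (transpose-ˡ i j)
  by-cases (no k≢i) (no k≢j) = trans (cong (transpose i j) (transpose-other k≢i k≢j)) (transpose-other k≢i k≢j)

transpose-injective : ∀ {n} {i j : Fin n} → j ≢ i → ∀ k l → transpose i j k ≡ transpose i j l → k ≡ l
transpose-injective {i = i} {j} j≢i k l eq =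
  trans (sym (transpose-involutive j≢i k)) (trans (cong (transpose i j) eq) (transpose-involutive j≢i l))

InE-fixed-unique : ∀ {n} {τ : Perm n} → InE τ → ∀ {a b} → lookup τ a ≡ a → lookup τ b ≡ b → a ≡ b
InE-fixed-unique (_ , m , _ , unique) a-fixed b-fixed = trans (unique _ a-fixed) (sym (unique _ b-fixed))

InE⇒¬InD : ∀ {n} {τ : Perm n} → InE τ → ¬ InD τ
InE⇒¬InD (_ , m , m-fixed , _) (_ , no-fixed) = no-fixed m m-fixed

-- Deleting n from the cycle decomposition

del-inject₁ : ∀ {k} (σ : Perm (suc k)) x v → lookup σ (inject₁ x) ≡ inject₁ v → lookup (del σ) x ≡ v
del-inject₁ σ x v eq with (lookup (del σ) x ≡ _ ∋ lookup∘tabulate _ x)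
... | p with lookup σ (inject₁ x) | eq
... | .(inject₁ v) | refl rewrite initLast-inject₁ v = p

del-bypass : ∀ {k} (σ : Perm (suc k)) x w → lookup σ (inject₁ x) ≡ fromℕ k → lookup σ (fromℕ k) ≡ inject₁ w →
             lookup (del σ) x ≡ w
del-bypass {k} σ x w eq eq′ with (lookup (del σ) x ≡ _ ∋ lookup∘tabulate _ x)
... | p with lookup σ (inject₁ x) | eq
... | .(fromℕ k) | refl with initLast (fromℕ k) | initLast-fromℕ k | p
... | .nothing | refl | p′ with lookup σ (fromℕ k) | eq′ | p′
... | .(inject₁ w) | refl | p″ rewrite initLast-inject₁ w = p″

-- Junk value of del: never reached when σ is a permutation.
del-default : ∀ {k} (σ : Perm (suc k)) x → lookup σ (inject₁ x) ≡ fromℕ k → lookup σ (fromℕ k) ≡ fromℕ k →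
              lookup (del σ) x ≡ x
del-default {k} σ x eq eq′ with (lookup (del σ) x ≡ _ ∋ lookup∘tabulate _ x)
... | p with lookup σ (inject₁ x) | eq
... | .(fromℕ k) | refl with initLast (fromℕ k) | initLast-fromℕ k | p
... | .nothing | refl | p′ with lookup σ (fromℕ k) | eq′ | p′
... | .(fromℕ k) | refl | p″ rewrite initLast-fromℕ k = p″

del-step : ∀ {k} (σ : Perm (suc k)) → IsPerm σ → ∀ x →
           inject₁ (lookup (del σ) x) ≡ lookup σ (inject₁ x)
           ⊎ (lookup σ (inject₁ x) ≡ fromℕ k × inject₁ (lookup (del σ) x) ≡ lookup σ (fromℕ k))
del-step {k} σ σ-perm x with fromℕ-or-inject₁ (lookup σ (inject₁ x))
... | inj₂ (v , e) = inj₁ (trans (cong inject₁ (del-inject₁ σ x v e)) (sym e))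
... | inj₁ e with fromℕ-or-inject₁ (lookup σ (fromℕ k))
...   | inj₁ e′ = ⊥-elim (inject₁≢fromℕ (σ-perm _ _ (trans e (sym e′))))
...   | inj₂ (w , e′) = inj₂ (e , trans (cong inject₁ (del-bypass σ x w e e′)) (sym e′))

del-IsPerm : ∀ {k} (σ : Perm (suc k)) → IsPerm σ → IsPerm (del σ)
del-IsPerm σ σ-perm x y eq with del-step σ σ-perm x | del-step σ σ-perm y
... | inj₁ a | inj₁ b = inject₁-injective (σ-perm _ _ (trans (sym a) (trans (cong inject₁ eq) b)))
... | inj₂ (a , _) | inj₂ (b , _) = inject₁-injective (σ-perm _ _ (trans a (sym b)))
... | inj₁ a | inj₂ (_ , b) = ⊥-elim (inject₁≢fromℕ (σ-perm _ _ (trans (sym a) (trans (cong inject₁ eq) b))))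
... | inj₂ (_ , a) | inj₁ b = ⊥-elim (inject₁≢fromℕ (σ-perm _ _ (trans (sym b) (trans (cong inject₁ (sym eq)) a))))

del-InD : ∀ {k} (σ : Perm (suc k)) → InD σ → lookup σ (lookup σ (fromℕ k)) ≢ fromℕ k → InD (del σ)
del-InD {k} σ (σ-perm , no-fixed) long-cycle = del-IsPerm σ σ-perm , no-fixed′
  where
  no-fixed′ : ∀ x → lookup (del σ) x ≢ x
  no-fixed′ x eq with del-step σ σ-perm x
  ... | inj₁ a = no-fixed (inject₁ x) (trans (sym a) (cong inject₁ eq))
  ... | inj₂ (a , b) = long-cycle (trans (cong (lookup σ) (trans (sym b) (cong inject₁ eq))) a)

del-InE-at : ∀ {k} (σ : Perm (suc k)) → InD σ → lookup σ (lookup σ (fromℕ k)) ≡ fromℕ k →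
             ∀ w → lookup σ (fromℕ k) ≡ inject₁ w → InE (del σ) × lookup (del σ) w ≡ w
del-InE-at {k} σ (σ-perm , no-fixed) two-cycle w σn≡w = (del-IsPerm σ σ-perm , w , w-fixed , unique) , w-fixed
  where
  w-fixed : lookup (del σ) w ≡ w
  w-fixed = del-bypass σ w w (trans (cong (lookup σ) (sym σn≡w)) two-cycle) σn≡w
  unique : ∀ x → lookup (del σ) x ≡ x → x ≡ w
  unique x eq with del-step σ σ-perm x
  ... | inj₁ a = ⊥-elim (no-fixed (inject₁ x) (trans (sym a) (cong inject₁ eq)))
  ... | inj₂ (_ , b) = inject₁-injective (trans (sym (cong inject₁ eq)) (trans b σn≡w))

del-InE : ∀ {k} (σ : Perm (suc k)) → InD σ → lookup σ (lookup σ (fromℕ k)) ≡ fromℕ k → InE (del σ)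
del-InE {k} σ d two-cycle with ≢fromℕ⇒inject₁ (proj₂ d (fromℕ k))
... | w , σn≡w = proj₁ (del-InE-at σ d two-cycle w σn≡w)

del-InD-fixed-last : ∀ {k} (τ : Perm (suc k)) → InE τ → lookup τ (fromℕ k) ≡ fromℕ k → InD (del τ)
del-InD-fixed-last τ τ∈E@(τ-perm , _) n-fixed = del-IsPerm τ τ-perm , no-fixed
  where
  no-fixed : ∀ x → lookup (del τ) x ≢ x
  no-fixed x e with del-step τ τ-perm x
  ... | inj₁ a = inject₁≢fromℕ (InE-fixed-unique {τ = τ} τ∈E (trans (sym a) (cong inject₁ e)) n-fixed)
  ... | inj₂ (τx≡n , _) = inject₁≢fromℕ (τ-perm _ _ (trans τx≡n (sym n-fixed)))

del-injective-at-last : ∀ {k} (σ₁ σ₂ : Perm (suc k)) → IsPerm σ₁ → IsPerm σ₂ →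
                        lookup σ₁ (fromℕ k) ≡ lookup σ₂ (fromℕ k) → del σ₁ ≡ del σ₂ → σ₁ ≡ σ₂
del-injective-at-last {k} σ₁ σ₂ p₁ p₂ same-last same-del = perm-ext agree
  where
  agree : ∀ y → lookup σ₁ y ≡ lookup σ₂ y
  agree y with fromℕ-or-inject₁ y
  ... | inj₁ refl = same-last
  ... | inj₂ (x , refl) with del-step σ₁ p₁ x | del-step σ₂ p₂ x | cong inject₁ (lookup-≗ same-del x)
  ...   | inj₁ a | inj₁ b | e = trans (sym a) (trans e b)
  ...   | inj₂ (a , _) | inj₂ (b , _) | _ = trans a (sym b)
  ...   | inj₁ a | inj₂ (_ , b) | e =
          ⊥-elim (inject₁≢fromℕ (p₁ _ _ (trans (sym a) (trans e (trans b (sym same-last))))))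
  ...   | inj₂ (_ , a) | inj₁ b | e =
          ⊥-elim (inject₁≢fromℕ (p₂ _ _ (trans (sym b) (trans (sym e) (trans a same-last)))))

del-injective-2-cycle : ∀ {k} (σ₁ σ₂ : Perm (suc k)) → InD σ₁ → InD σ₂ →
                        lookup σ₁ (lookup σ₁ (fromℕ k)) ≡ fromℕ k → lookup σ₂ (lookup σ₂ (fromℕ k)) ≡ fromℕ k →
                        del σ₁ ≡ del σ₂ → σ₁ ≡ σ₂
del-injective-2-cycle {k} σ₁ σ₂ d₁ d₂ c₁ c₂ same-del with ≢fromℕ⇒inject₁ (proj₂ d₁ (fromℕ k)) | ≢fromℕ⇒inject₁ (proj₂ d₂ (fromℕ k))
... | w₁ , e₁ | w₂ , e₂ = del-injective-at-last σ₁ σ₂ (proj₁ d₁) (proj₁ d₂) same-last same-del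
  where
  -- σ(n) is recovered from del σ as its unique fixed point.
  E₁ = del-InE-at σ₁ d₁ c₁ w₁ e₁
  E₂ = del-InE-at σ₂ d₂ c₂ w₂ e₂
  same-last : lookup σ₁ (fromℕ k) ≡ lookup σ₂ (fromℕ k)
  same-last = trans e₁ (trans (cong inject₁ (InE-fixed-unique {τ = del σ₂} (proj₁ E₂) (trans (sym (lookup-≗ same-del w₁)) (proj₂ E₁)) (proj₂ E₂))) (sym e₂))

-- The maps f and γ

f-last-last : ∀ {k} (ρ : Perm k) → lookup (f k (fromℕ k) ρ) (fromℕ k) ≡ fromℕ k
f-last-last {k} ρ = at (fromℕ k) (fromℕ k) (initLast-fromℕ k) (initLast-fromℕ k)
  where
  at : ∀ m y → initLast m ≡ nothing → initLast y ≡ nothing → lookup (f k m ρ) y ≡ fromℕ k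
  at m zero e e′ with (lookup (f k m ρ) zero ≡ _ ∋ refl)
  ... | p with initLast m | e | initLast {k} zero | e′ | p
  ... | .nothing | refl | .nothing | refl | p′ = p′
  at m (suc y) e e′ with (lookup (f k m ρ) (suc y) ≡ _ ∋ lookup∘tabulate _ y)
  ... | p with initLast m | e | initLast {k} (suc y) | e′ | p
  ... | .nothing | refl | .nothing | refl | p′ = p′

f-last-inject₁ : ∀ {k} (ρ : Perm k) y → lookup (f k (fromℕ k) ρ) (inject₁ y) ≡ inject₁ (lookup ρ y)
f-last-inject₁ {k} ρ y = at (fromℕ k) (inject₁ y) y (initLast-fromℕ k) (initLast-inject₁ y)
  where
  at : ∀ m y y′ → initLast m ≡ nothing → initLast y ≡ just y′ → lookup (f k m ρ) y ≡ inject₁ (lookup ρ y′)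
  at m zero y′ e e′ with (lookup (f k m ρ) zero ≡ _ ∋ refl)
  ... | p with initLast m | e | initLast {k} zero | e′ | p
  ... | .nothing | refl | .(just y′) | refl | p′ = p′
  at m (suc y) y′ e e′ with (lookup (f k m ρ) (suc y) ≡ _ ∋ lookup∘tabulate _ y)
  ... | p with initLast m | e | initLast {k} (suc y) | e′ | p
  ... | .nothing | refl | .(just y′) | refl | p′ = p′

f-inject₁-last : ∀ {k} (ρ : Perm k) m → lookup (f k (inject₁ m) ρ) (fromℕ k) ≡ inject₁ (lookup ρ m)
f-inject₁-last {k} ρ m = at (inject₁ m) m (fromℕ k) (initLast-inject₁ m) (initLast-fromℕ k)
  where
  at : ∀ m m′ y → initLast m ≡ just m′ → initLast y ≡ nothing → lookup (f k m ρ) y ≡ inject₁ (lookup ρ m′)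
  at m m′ zero e e′ with (lookup (f k m ρ) zero ≡ _ ∋ refl)
  ... | p with initLast m | e | initLast {k} zero | e′ | p
  ... | .(just m′) | refl | .nothing | refl | p′ = p′
  at m m′ (suc y) e e′ with (lookup (f k m ρ) (suc y) ≡ _ ∋ lookup∘tabulate _ y)
  ... | p with initLast m | e | initLast {k} (suc y) | e′ | p
  ... | .(just m′) | refl | .nothing | refl | p′ = p′

f-inject₁-self : ∀ {k} (ρ : Perm k) m → lookup (f k (inject₁ m) ρ) (inject₁ m) ≡ inject₁ m
f-inject₁-self {k} ρ m = at (inject₁ m) m (inject₁ m) (initLast-inject₁ m) (initLast-inject₁ m)
  where
  at : ∀ m m′ y → initLast m ≡ just m′ → initLast y ≡ just m′ → lookup (f k m ρ) y ≡ inject₁ m′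
  at m m′ zero e e′ with (lookup (f k m ρ) zero ≡ _ ∋ refl)
  ... | p with initLast m | e | initLast {k} zero | e′ | p
  ... | .(just m′) | refl | .(just m′) | refl | p′ with m′ ≟ m′ | p′
  ...   | yes _ | p″ = p″
  ...   | no m′≢m′ | _ = contradiction refl m′≢m′
  at m m′ (suc y) e e′ with (lookup (f k m ρ) (suc y) ≡ _ ∋ lookup∘tabulate _ y)
  ... | p with initLast m | e | initLast {k} (suc y) | e′ | p
  ... | .(just m′) | refl | .(just m′) | refl | p′ with m′ ≟ m′ | p′
  ...   | yes _ | p″ = p″
  ...   | no m′≢m′ | _ = contradiction refl m′≢m′

f-inject₁-pred : ∀ {k} (ρ : Perm k) m y → y ≢ m → lookup ρ y ≡ m → lookup (f k (inject₁ m) ρ) (inject₁ y) ≡ fromℕ k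
f-inject₁-pred {k} ρ m y = at (inject₁ m) m (inject₁ y) y (initLast-inject₁ m) (initLast-inject₁ y)
  where
  at : ∀ m m′ y y′ → initLast m ≡ just m′ → initLast y ≡ just y′ → y′ ≢ m′ → lookup ρ y′ ≡ m′ →
       lookup (f k m ρ) y ≡ fromℕ k
  at m m′ zero y′ e e′ y′≢m′ ρy′≡m′ with (lookup (f k m ρ) zero ≡ _ ∋ refl)
  ... | p with initLast m | e | initLast {k} zero | e′ | p
  ... | .(just m′) | refl | .(just y′) | refl | p′ with y′ ≟ m′ | p′
  ...   | yes y′≡m′ | _ = contradiction y′≡m′ y′≢m′
  ...   | no _ | p″ with lookup ρ y′ ≟ m′ | p″
  ...     | yes _ | p‴ = p‴
  ...     | no ρy′≢m′ | _ = contradiction ρy′≡m′ ρy′≢m′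
  at m m′ (suc y) y′ e e′ y′≢m′ ρy′≡m′ with (lookup (f k m ρ) (suc y) ≡ _ ∋ lookup∘tabulate _ y)
  ... | p with initLast m | e | initLast {k} (suc y) | e′ | p
  ... | .(just m′) | refl | .(just y′) | refl | p′ with y′ ≟ m′ | p′
  ...   | yes y′≡m′ | _ = contradiction y′≡m′ y′≢m′
  ...   | no _ | p″ with lookup ρ y′ ≟ m′ | p″
  ...     | yes _ | p‴ = p‴
  ...     | no ρy′≢m′ | _ = contradiction ρy′≡m′ ρy′≢m′

f-inject₁-other : ∀ {k} (ρ : Perm k) m y → y ≢ m → lookup ρ y ≢ m →
                  lookup (f k (inject₁ m) ρ) (inject₁ y) ≡ inject₁ (lookup ρ y)
f-inject₁-other {k} ρ m y = at (inject₁ m) m (inject₁ y) y (initLast-inject₁ m) (initLast-inject₁ y)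
  where
  at : ∀ m m′ y y′ → initLast m ≡ just m′ → initLast y ≡ just y′ → y′ ≢ m′ → lookup ρ y′ ≢ m′ →
       lookup (f k m ρ) y ≡ inject₁ (lookup ρ y′)
  at m m′ zero y′ e e′ y′≢m′ ρy′≢m′ with (lookup (f k m ρ) zero ≡ _ ∋ refl)
  ... | p with initLast m | e | initLast {k} zero | e′ | p
  ... | .(just m′) | refl | .(just y′) | refl | p′ with y′ ≟ m′ | p′
  ...   | yes y′≡m′ | _ = contradiction y′≡m′ y′≢m′
  ...   | no _ | p″ with lookup ρ y′ ≟ m′ | p″
  ...     | yes ρy′≡m′ | _ = contradiction ρy′≡m′ ρy′≢m′
  ...     | no _ | p‴ = p‴
  at m m′ (suc y) y′ e e′ y′≢m′ ρy′≢m′ with (lookup (f k m ρ) (suc y) ≡ _ ∋ lookup∘tabulate _ y)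
  ... | p with initLast m | e | initLast {k} (suc y) | e′ | p
  ... | .(just m′) | refl | .(just y′) | refl | p′ with y′ ≟ m′ | p′
  ...   | yes y′≡m′ | _ = contradiction y′≡m′ y′≢m′
  ...   | no _ | p″ with lookup ρ y′ ≟ m′ | p″
  ...     | yes ρy′≡m′ | _ = contradiction ρy′≡m′ ρy′≢m′
  ...     | no _ | p‴ = p‴

γ-last : ∀ {k} m (σ : Perm k) → lookup (γ k m σ) (fromℕ k) ≡ inject₁ m
γ-last {k} m σ = at (fromℕ k) (initLast-fromℕ k)
  where
  at : ∀ y → initLast y ≡ nothing → lookup (γ k m σ) y ≡ inject₁ m
  at zero e with (lookup (γ k m σ) zero ≡ _ ∋ refl)
  ... | p with initLast {k} zero | e | p
  ... | .nothing | refl | p′ = p′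
  at (suc y) e with (lookup (γ k m σ) (suc y) ≡ _ ∋ lookup∘tabulate _ y)
  ... | p with initLast {k} (suc y) | e | p
  ... | .nothing | refl | p′ = p′

γ-fixed : ∀ {k} m (σ : Perm k) → lookup (γ k m σ) (inject₁ m) ≡ fromℕ k
γ-fixed {k} m σ = at (inject₁ m) (initLast-inject₁ m)
  where
  at : ∀ y → initLast y ≡ just m → lookup (γ k m σ) y ≡ fromℕ k
  at zero e with (lookup (γ k m σ) zero ≡ _ ∋ refl)
  ... | p with initLast {k} zero | e | p
  ... | .(just m) | refl | p′ with m ≟ m | p′
  ...   | yes _ | p″ = p″
  ...   | no m≢m | _ = contradiction refl m≢m
  at (suc y) e with (lookup (γ k m σ) (suc y) ≡ _ ∋ lookup∘tabulate _ y)
  ... | p with initLast {k} (suc y) | e | p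
  ... | .(just m) | refl | p′ with m ≟ m | p′
  ...   | yes _ | p″ = p″
  ...   | no m≢m | _ = contradiction refl m≢m

γ-other : ∀ {k} m (σ : Perm k) y → y ≢ m → lookup (γ k m σ) (inject₁ y) ≡ inject₁ (lookup σ y)
γ-other {k} m σ y = at (inject₁ y) y (initLast-inject₁ y)
  where
  at : ∀ y y′ → initLast y ≡ just y′ → y′ ≢ m → lookup (γ k m σ) y ≡ inject₁ (lookup σ y′)
  at zero y′ e y′≢m with (lookup (γ k m σ) zero ≡ _ ∋ refl)
  ... | p with initLast {k} zero | e | p
  ... | .(just y′) | refl | p′ with y′ ≟ m | p′
  ...   | yes y′≡m | _ = contradiction y′≡m y′≢m
  ...   | no _ | p″ = p″
  at (suc y) y′ e y′≢m with (lookup (γ k m σ) (suc y) ≡ _ ∋ lookup∘tabulate _ y)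
  ... | p with initLast {k} (suc y) | e | p
  ... | .(just y′) | refl | p′ with y′ ≟ m | p′
  ...   | yes y′≡m | _ = contradiction y′≡m y′≢m
  ...   | no _ | p″ = p″

γ-InD : ∀ {k} m (σ : Perm k) → InE σ → lookup σ m ≡ m → InD (γ k m σ)
γ-InD {k} m σ σ∈E@(σ-perm , _) m-fixed = γ-perm , no-fixed
  where
  γσ = γ k m σ
  γ-perm : IsPerm γσ
  γ-perm y₁ y₂ eq with fromℕ-or-inject₁ y₁ | fromℕ-or-inject₁ y₂
  ... | inj₁ refl | inj₁ refl = refl
  ... | inj₁ refl | inj₂ (z , refl) with z ≟ m
  ...   | yes refl = ⊥-elim (inject₁≢fromℕ (trans (sym (γ-last m σ)) (trans eq (γ-fixed m σ))))
  ...   | no z≢m = contradiction (σ-perm _ _ (trans (inject₁-injective (trans (sym (γ-other m σ z z≢m)) (trans (sym eq) (γ-last m σ)))) (sym m-fixed))) z≢m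
  γ-perm y₁ y₂ eq | inj₂ (z , refl) | inj₁ refl with z ≟ m
  ...   | yes refl = ⊥-elim (inject₁≢fromℕ (trans (sym (γ-last m σ)) (trans (sym eq) (γ-fixed m σ))))
  ...   | no z≢m = contradiction (σ-perm _ _ (trans (inject₁-injective (trans (sym (γ-other m σ z z≢m)) (trans eq (γ-last m σ)))) (sym m-fixed))) z≢m
  γ-perm y₁ y₂ eq | inj₂ (z₁ , refl) | inj₂ (z₂ , refl) with z₁ ≟ m | z₂ ≟ m
  ... | yes refl | yes refl = refl
  ... | yes refl | no z₂≢m = ⊥-elim (inject₁≢fromℕ (trans (sym (γ-other m σ z₂ z₂≢m)) (trans (sym eq) (γ-fixed m σ))))
  ... | no z₁≢m | yes refl = ⊥-elim (inject₁≢fromℕ (trans (sym (γ-other m σ z₁ z₁≢m)) (trans eq (γ-fixed m σ))))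
  ... | no z₁≢m | no z₂≢m =
        cong inject₁ (σ-perm _ _ (inject₁-injective (trans (sym (γ-other m σ z₁ z₁≢m)) (trans eq (γ-other m σ z₂ z₂≢m)))))
  no-fixed : ∀ y → lookup γσ y ≢ y
  no-fixed y eq with fromℕ-or-inject₁ y
  ... | inj₁ refl = inject₁≢fromℕ (trans (sym (γ-last m σ)) eq)
  ... | inj₂ (z , refl) with z ≟ m
  ...   | yes refl = inject₁≢fromℕ (trans (sym eq) (γ-fixed m σ))
  ...   | no z≢m = z≢m (InE-fixed-unique {τ = σ} σ∈E (inject₁-injective (trans (sym (γ-other m σ z z≢m)) eq)) m-fixed)

γ-2-cycle : ∀ {k} m (σ : Perm k) → lookup (γ k m σ) (lookup (γ k m σ) (fromℕ k)) ≡ fromℕ k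
γ-2-cycle {k} m σ = trans (cong (lookup (γ k m σ)) (γ-last m σ)) (γ-fixed m σ)

del-γ : ∀ {k} m (σ : Perm k) → lookup σ m ≡ m → del (γ k m σ) ≡ σ
del-γ {k} m σ m-fixed = perm-ext agree
  where
  agree : ∀ x → lookup (del (γ k m σ)) x ≡ lookup σ x
  agree x with x ≟ m
  ... | yes refl = trans (del-bypass (γ k m σ) m m (γ-fixed m σ) (γ-last m σ)) (sym m-fixed)
  ... | no x≢m = del-inject₁ (γ k m σ) x _ (γ-other m σ x x≢m)

f-last-IsPerm : ∀ {k} (ρ : Perm k) → IsPerm ρ → IsPerm (f k (fromℕ k) ρ)
f-last-IsPerm {k} ρ ρ-perm y₁ y₂ eq with fromℕ-or-inject₁ y₁ | fromℕ-or-inject₁ y₂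
... | inj₁ refl | inj₁ refl = refl
... | inj₁ refl | inj₂ (z , refl) = ⊥-elim (inject₁≢fromℕ (trans (sym (f-last-inject₁ ρ z)) (trans (sym eq) (f-last-last ρ))))
... | inj₂ (z , refl) | inj₁ refl = ⊥-elim (inject₁≢fromℕ (trans (sym (f-last-inject₁ ρ z)) (trans eq (f-last-last ρ))))
... | inj₂ (z₁ , refl) | inj₂ (z₂ , refl) =
      cong inject₁ (ρ-perm _ _ (inject₁-injective (trans (sym (f-last-inject₁ ρ z₁)) (trans eq (f-last-inject₁ ρ z₂)))))

f-last-fixed⇒last : ∀ {k} (ρ : Perm k) → InD ρ → ∀ y → lookup (f k (fromℕ k) ρ) y ≡ y → y ≡ fromℕ k
f-last-fixed⇒last ρ (_ , no-fixed) y eq with fromℕ-or-inject₁ y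
... | inj₁ y≡n = y≡n
... | inj₂ (z , refl) = contradiction (inject₁-injective (trans (sym (f-last-inject₁ ρ z)) eq)) (no-fixed z)

f-conjugate : ∀ {k} (ρ : Perm k) → InD ρ → ∀ m y →
              lookup (f k (inject₁ m) ρ) y
              ≡ transpose (fromℕ k) (inject₁ m) (lookup (f k (fromℕ k) ρ) (transpose (fromℕ k) (inject₁ m) y))
f-conjugate {k} ρ (_ , no-fixed) m y = by-cases (fromℕ-or-inject₁ y)
  where
  t = transpose (fromℕ k) (inject₁ m)
  F = lookup (f k (fromℕ k) ρ)
  via : ∀ y {y₁ v w} → t y ≡ y₁ → F y₁ ≡ v → t v ≡ w → t (F (t y)) ≡ w
  via _ refl refl refl = refl
  by-cases : y ≡ fromℕ k ⊎ ∃ (λ i → y ≡ inject₁ i) → lookup (f k (inject₁ m) ρ) y ≡ t (F (t y))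
  by-cases (inj₁ refl) =
    trans (f-inject₁-last ρ m)
          (sym (via (fromℕ k) (transpose-ˡ (fromℕ k) (inject₁ m)) (f-last-inject₁ ρ m) (transpose-other inject₁≢fromℕ (no-fixed m ∘ inject₁-injective))))
  by-cases (inj₂ (z , refl)) with z ≟ m
  ... | yes refl = trans (f-inject₁-self ρ z) (sym (via (inject₁ z) (transpose-ʳ (inject₁≢fromℕ {i = z})) (f-last-last ρ) (transpose-ˡ (fromℕ k) (inject₁ z))))
  ... | no z≢m with lookup ρ z ≟ m
  ...   | yes ρz≡m =
          trans (f-inject₁-pred ρ m z z≢m ρz≡m)
                (sym (via (inject₁ z) (transpose-other (inject₁≢fromℕ {i = z}) (z≢m ∘ inject₁-injective))
                          (trans (f-last-inject₁ ρ z) (cong inject₁ ρz≡m)) (transpose-ʳ (inject₁≢fromℕ {i = m}))))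
  ...   | no ρz≢m =
          trans (f-inject₁-other ρ m z z≢m ρz≢m)
                (sym (via (inject₁ z) (transpose-other (inject₁≢fromℕ {i = z}) (z≢m ∘ inject₁-injective))
                          (f-last-inject₁ ρ z) (transpose-other inject₁≢fromℕ (ρz≢m ∘ inject₁-injective))))

f-fixes : ∀ {k} (ρ : Perm k) m → lookup (f k m ρ) m ≡ m
f-fixes {k} ρ m with fromℕ-or-inject₁ m
... | inj₁ refl = f-last-last ρ
... | inj₂ (m′ , refl) = f-inject₁-self ρ m′

f-InE : ∀ {k} (ρ : Perm k) → InD ρ → ∀ m → InE (f k m ρ)
f-InE {k} ρ ρ∈D m with fromℕ-or-inject₁ m
... | inj₁ refl = f-last-IsPerm ρ (proj₁ ρ∈D) , fromℕ k , f-last-last ρ , f-last-fixed⇒last ρ ρ∈D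
... | inj₂ (m′ , refl) = fm-perm , inject₁ m′ , f-inject₁-self ρ m′ , unique
  where
  t = transpose (fromℕ k) (inject₁ m′)
  conj = f-conjugate ρ ρ∈D m′
  t-injective = transpose-injective inject₁≢fromℕ
  fm-perm : IsPerm (f k (inject₁ m′) ρ)
  fm-perm y z eq = t-injective y z (f-last-IsPerm ρ (proj₁ ρ∈D) _ _ (t-injective _ _ (trans (sym (conj y)) (trans eq (conj z)))))
  unique : ∀ y → lookup (f k (inject₁ m′) ρ) y ≡ y → y ≡ inject₁ m′
  unique y eq = begin
    y                ≡⟨ sym (transpose-involutive inject₁≢fromℕ y) ⟩
    t (t y)          ≡⟨ cong t (f-last-fixed⇒last ρ ρ∈D (t y) ty-fixed) ⟩
    t (fromℕ k)      ≡⟨ transpose-ˡ (fromℕ k) (inject₁ m′) ⟩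
    inject₁ m′       ∎
    where
    open ≡-Reasoning
    ty-fixed : lookup (f k (fromℕ k) ρ) (t y) ≡ t y
    ty-fixed = trans (sym (transpose-involutive inject₁≢fromℕ _)) (cong t (trans (sym (conj y)) eq))

f-injectiveʳ : ∀ {k} m (ρ₁ ρ₂ : Perm k) → f k m ρ₁ ≡ f k m ρ₂ → ρ₁ ≡ ρ₂
f-injectiveʳ {k} m ρ₁ ρ₂ eq = perm-ext agree
  where
  at : ∀ y → lookup (f k m ρ₁) y ≡ lookup (f k m ρ₂) y
  at = lookup-≗ eq
  agree : ∀ x → lookup ρ₁ x ≡ lookup ρ₂ x
  agree x with fromℕ-or-inject₁ m
  ... | inj₁ refl = inject₁-injective (trans (sym (f-last-inject₁ ρ₁ x)) (trans (at (inject₁ x)) (f-last-inject₁ ρ₂ x)))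
  ... | inj₂ (m′ , refl) with x ≟ m′
  ...   | yes refl = inject₁-injective (trans (sym (f-inject₁-last ρ₁ x)) (trans (at (fromℕ k)) (f-inject₁-last ρ₂ x)))
  ...   | no x≢m′ with lookup ρ₁ x ≟ m′ | lookup ρ₂ x ≟ m′
  ...     | yes e₁ | yes e₂ = trans e₁ (sym e₂)
  ...     | yes e₁ | no n₂ = ⊥-elim (inject₁≢fromℕ (trans (sym (f-inject₁-other ρ₂ m′ x x≢m′ n₂))
                                    (trans (sym (at (inject₁ x))) (f-inject₁-pred ρ₁ m′ x x≢m′ e₁))))
  ...     | no n₁ | yes e₂ = ⊥-elim (inject₁≢fromℕ (trans (sym (f-inject₁-other ρ₁ m′ x x≢m′ n₁))
                                    (trans (at (inject₁ x)) (f-inject₁-pred ρ₂ m′ x x≢m′ e₂))))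
  ...     | no n₁ | no n₂ = inject₁-injective (trans (sym (f-inject₁-other ρ₁ m′ x x≢m′ n₁))
                                    (trans (at (inject₁ x)) (f-inject₁-other ρ₂ m′ x x≢m′ n₂)))

f-fixed-point-injective : ∀ {k} (ρ₁ ρ₂ : Perm k) m₁ m₂ → InD ρ₂ → f k m₁ ρ₁ ≡ f k m₂ ρ₂ → m₁ ≡ m₂
f-fixed-point-injective {k} ρ₁ ρ₂ m₁ m₂ ρ₂∈D eq =
  InE-fixed-unique {τ = f k m₂ ρ₂} (f-InE ρ₂ ρ₂∈D m₂) (trans (sym (lookup-≗ eq m₁)) (f-fixes ρ₁ m₁)) (f-fixes ρ₂ m₂)

f-last-del : ∀ {k} (τ : Perm (suc k)) → IsPerm τ → lookup τ (fromℕ k) ≡ fromℕ k → f k (fromℕ k) (del τ) ≡ τ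
f-last-del {k} τ τ-perm n-fixed = perm-ext agree
  where
  agree : ∀ y → lookup (f k (fromℕ k) (del τ)) y ≡ lookup τ y
  agree y with fromℕ-or-inject₁ y
  ... | inj₁ refl = trans (f-last-last (del τ)) (sym n-fixed)
  ... | inj₂ (z , refl) with del-step τ τ-perm z
  ...   | inj₁ e = trans (f-last-inject₁ (del τ) z) e
  ...   | inj₂ (e , _) = ⊥-elim (inject₁≢fromℕ (τ-perm _ _ (trans e (sym n-fixed))))

del-f-last : ∀ {k} (ρ : Perm k) → del (f k (fromℕ k) ρ) ≡ ρ
del-f-last {k} ρ = perm-ext λ x → del-inject₁ (f k (fromℕ k) ρ) x _ (f-last-inject₁ ρ x)

-- The permutations π_n

2∤1 : 2 ∤ 1
2∤1 h with ∣1⇒≡1 h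
... | ()

2∣-pred₂ : ∀ {n} → 2 ∣ suc (suc n) → 2 ∣ n
2∣-pred₂ h = ∣m+n∣m⇒∣n h ∣-refl

2∣-suc₂ : ∀ {n} → 2 ∣ n → 2 ∣ suc (suc n)
2∣-suc₂ = ∣m∣n⇒∣m+n ∣-refl

2∣⇒2∤suc : ∀ n → 2 ∣ n → 2 ∤ suc n
2∣⇒2∤suc zero _ = 2∤1
2∣⇒2∤suc (suc zero) h _ = 2∤1 h
2∣⇒2∤suc (suc (suc n)) h h' = 2∣⇒2∤suc n (2∣-pred₂ h) (2∣-pred₂ h')

2∤⇒2∣suc : ∀ n → 2 ∤ n → 2 ∣ suc n
2∤⇒2∣suc zero h = contradiction (2 ∣0) h
2∤⇒2∣suc (suc zero) _ = ∣-refl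
2∤⇒2∣suc (suc (suc n)) h = 2∣-suc₂ (2∤⇒2∣suc n (h ∘ 2∣-suc₂))

2∤suc⇒2∣ : ∀ n → 2 ∤ suc n → 2 ∣ n
2∤suc⇒2∣ zero _ = 2 ∣0
2∤suc⇒2∣ (suc zero) h = contradiction ∣-refl h
2∤suc⇒2∣ (suc (suc n)) h = 2∣-suc₂ (2∤suc⇒2∣ n (h ∘ 2∣-suc₂))

prefix12 : ∀ {n} → Perm n → Perm (suc (suc n))
prefix12 v = suc zero ∷ zero ∷ map (λ j → suc (suc j)) v

lookup-prefix12 : ∀ {n} (v : Perm n) i {u} → lookup v i ≡ u → lookup (prefix12 v) (suc (suc i)) ≡ suc (suc u)
lookup-prefix12 v i e = trans (lookup-map i _ v) (cong (λ j → suc (suc j)) e)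

prefix12-InD : ∀ {n} (v : Perm n) → InD v → InD (prefix12 v)
prefix12-InD v (v-perm , no-fixed) = perm , no-fixed′
  where
  perm : IsPerm (prefix12 v)
  perm zero zero _ = refl
  perm (suc zero) (suc zero) _ = refl
  perm zero (suc zero) ()
  perm (suc zero) zero ()
  perm zero (suc (suc j)) e with trans e (lookup-prefix12 v j refl)
  ... | ()
  perm (suc zero) (suc (suc j)) e with trans e (lookup-prefix12 v j refl)
  ... | ()
  perm (suc (suc i)) zero e with trans (sym e) (lookup-prefix12 v i refl)
  ... | ()
  perm (suc (suc i)) (suc zero) e with trans (sym e) (lookup-prefix12 v i refl)
  ... | ()
  perm (suc (suc i)) (suc (suc j)) e =
    cong (λ j → suc (suc j)) (v-perm i j (suc-injective (suc-injective
      (trans (sym (lookup-prefix12 v i refl)) (trans e (lookup-prefix12 v j refl))))))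
  no-fixed′ : ∀ x → lookup (prefix12 v) x ≢ x
  no-fixed′ zero ()
  no-fixed′ (suc zero) ()
  no-fixed′ (suc (suc i)) e = no-fixed i (suc-injective (suc-injective (trans (sym (lookup-prefix12 v i refl)) e)))

del-prefix12 : ∀ {m} (v : Perm (suc m)) → del (prefix12 v) ≡ prefix12 (del v)
del-prefix12 {m} v = perm-ext agree
  where
  agree : ∀ x → lookup (del (prefix12 v)) x ≡ lookup (prefix12 (del v)) x
  agree zero = del-inject₁ (prefix12 v) zero (suc zero) refl
  agree (suc zero) = del-inject₁ (prefix12 v) (suc zero) zero refl
  agree (suc (suc x)) with fromℕ-or-inject₁ (lookup v (inject₁ x))
  ... | inj₂ (u , e) =
        trans (del-inject₁ (prefix12 v) (suc (suc x)) (suc (suc u)) (lookup-prefix12 v (inject₁ x) e)) (sym (lookup-prefix12 (del v) x (del-inject₁ v x u e)))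
  ... | inj₁ e with fromℕ-or-inject₁ (lookup v (fromℕ m))
  ...   | inj₂ (w , e′) =
          trans (del-bypass (prefix12 v) (suc (suc x)) (suc (suc w)) (lookup-prefix12 v (inject₁ x) e) (lookup-prefix12 v (fromℕ m) e′))
                (sym (lookup-prefix12 (del v) x (del-bypass v x w e e′)))
  ...   | inj₁ e′ =
          trans (del-default (prefix12 v) (suc (suc x)) (lookup-prefix12 v (inject₁ x) e) (lookup-prefix12 v (fromℕ m) e′))
                (sym (lookup-prefix12 (del v) x (del-default v x e e′)))

f-last-prefix12 : ∀ {m} (v : Perm m) → f (suc (suc m)) (fromℕ (suc (suc m))) (prefix12 v) ≡ prefix12 (f m (fromℕ m) v)
f-last-prefix12 {m} v = perm-ext agree
  where
  agree : ∀ y → lookup (f (suc (suc m)) (fromℕ (suc (suc m))) (prefix12 v)) y ≡ lookup (prefix12 (f m (fromℕ m) v)) y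
  agree zero = f-last-inject₁ (prefix12 v) zero
  agree (suc zero) = f-last-inject₁ (prefix12 v) (suc zero)
  agree (suc (suc y)) with fromℕ-or-inject₁ y
  ... | inj₁ refl = trans (f-last-last (prefix12 v)) (sym (lookup-prefix12 (f m (fromℕ m) v) (fromℕ m) (f-last-last v)))
  ... | inj₂ (z , refl) =
        trans (f-last-inject₁ (prefix12 v) (suc (suc z)))
              (trans (cong inject₁ (lookup-prefix12 v z refl)) (sym (lookup-prefix12 (f m (fromℕ m) v) (inject₁ z) (f-last-inject₁ v z))))

π-InD : ∀ n → 2 ∣ n → InD (π n)
π-InD zero _ = (λ ()) , (λ ())
π-InD (suc zero) 2∣1 = contradiction 2∣1 2∤1
π-InD (suc (suc n)) 2∣n+2 = prefix12-InD (π n) (π-InD n (2∣-pred₂ 2∣n+2))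

π-fixes-last : ∀ k → 2 ∤ suc k → lookup (π (suc k)) (fromℕ k) ≡ fromℕ k
π-fixes-last zero _ = refl
π-fixes-last (suc zero) 2∤2 = contradiction ∣-refl 2∤2
π-fixes-last (suc (suc k)) 2∤k+3 = lookup-prefix12 (π (suc k)) (fromℕ k) (π-fixes-last k (2∤k+3 ∘ 2∣-suc₂))

π-¬InD : ∀ k → 2 ∤ suc k → ¬ InD (π (suc k))
π-¬InD k 2∤k+1 (_ , no-fixed) = no-fixed (fromℕ k) (π-fixes-last k 2∤k+1)

π-last-2-cycle : ∀ k → 2 ∣ suc (suc k) → lookup (π (suc (suc k))) (lookup (π (suc (suc k))) (fromℕ (suc k))) ≡ fromℕ (suc k)
π-last-2-cycle zero _ = refl
π-last-2-cycle (suc zero) 2∣3 = contradiction (2∣-pred₂ 2∣3) 2∤1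
π-last-2-cycle (suc (suc k)) 2∣k+4 =
  trans (cong (lookup (prefix12 v)) (lookup-prefix12 v (fromℕ (suc k)) refl))
        (lookup-prefix12 v (lookup v (fromℕ (suc k))) (π-last-2-cycle k (2∣-pred₂ 2∣k+4)))
  where v = π (suc (suc k))

del-π : ∀ k → 2 ∣ suc (suc k) → del (π (suc (suc k))) ≡ π (suc k)
del-π zero _ = refl
del-π (suc zero) 2∣3 = contradiction (2∣-pred₂ 2∣3) 2∤1
del-π (suc (suc k)) 2∣k+4 = trans (del-prefix12 (π (suc (suc k)))) (cong prefix12 (del-π k (2∣-pred₂ 2∣k+4)))

f-last-π : ∀ k → 2 ∤ suc (suc k) → f (suc k) (fromℕ (suc k)) (π (suc k)) ≡ π (suc (suc k))
f-last-π zero 2∤2 = contradiction ∣-refl 2∤2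
f-last-π (suc zero) _ = refl
f-last-π (suc (suc k)) 2∤k+4 = trans (f-last-prefix12 (π (suc k))) (cong prefix12 (f-last-π k (2∤k+4 ∘ 2∣-suc₂)))

-- The bijection α_n

AlphaDom : ∀ n → Perm n → Set
AlphaDom n σ = InD σ ⊎ (2 ∤ n × σ ≡ π n)

AlphaCod : ∀ n → Perm n → Set
AlphaCod n τ = InE τ ⊎ (2 ∣ n × τ ≡ π n)

AlphaDom-odd⇒InD : ∀ k {ρ : Perm (suc k)} → 2 ∤ suc (suc k) → AlphaDom (suc k) ρ → InD ρ
AlphaDom-odd⇒InD k _ (inj₁ ρ∈D) = ρ∈D
AlphaDom-odd⇒InD k 2∤k+2 (inj₂ (2∤k+1 , _)) = contradiction (2∤⇒2∣suc (suc k) 2∤k+1) 2∤k+2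

Fin1-zero : (x : Fin 1) → x ≡ zero
Fin1-zero zero = refl

Alpha-dom : ∀ {n σ τ} → Alpha n σ τ → AlphaDom n σ
Alpha-dom α0 = inj₁ ((λ ()) , (λ ()))
Alpha-dom α1 = inj₂ (2∤1 , refl)
Alpha-dom (αi _ d _) = inj₁ d
Alpha-dom (αiiD _ _ d _ _ _) = inj₁ d
Alpha-dom (αiiΠ _ d _ _ _) = inj₁ d
Alpha-dom (αiii _ 2∤k+2 _) = inj₂ (2∤k+2 , refl)

Alpha-cod : ∀ {n σ τ} → Alpha n σ τ → AlphaCod n τ
Alpha-cod α0 = inj₂ (2 ∣0 , refl)
Alpha-cod α1 = inj₁ ((λ x y _ → trans (Fin1-zero x) (sym (Fin1-zero y))) , zero , refl , λ x _ → Fin1-zero x)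
Alpha-cod (αi {k} σ d long) = inj₁ (f-InE (del σ) (del-InD σ d long) (lookup σ (fromℕ (suc k))))
Alpha-cod (αiiD {k} _ ρ _ _ _ ρ∈D) = inj₁ (f-InE ρ ρ∈D (fromℕ (suc k)))
Alpha-cod (αiiΠ _ _ _ 2∣k+2 _) = inj₂ (2∣k+2 , refl)
Alpha-cod (αiii {k} ρ 2∤k+2 a) = inj₁ (f-InE ρ (AlphaDom-odd⇒InD k 2∤k+2 (Alpha-dom a)) (fromℕ (suc k)))

f≢π-even : ∀ {k} (ρ : Perm k) m → InD ρ → 2 ∣ suc k → f k m ρ ≢ π (suc k)
f≢π-even {k} ρ m ρ∈D 2∣k+1 eq = InE⇒¬InD {τ = π (suc k)} (subst InE eq (f-InE ρ ρ∈D m)) (π-InD (suc k) 2∣k+1)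

Alpha-functional : ∀ n {σ₁ σ₂ τ₁ τ₂} → Alpha n σ₁ τ₁ → Alpha n σ₂ τ₂ → σ₁ ≡ σ₂ → τ₁ ≡ τ₂
Alpha-injective : ∀ n {σ₁ σ₂ τ₁ τ₂} → Alpha n σ₁ τ₁ → Alpha n σ₂ τ₂ → τ₁ ≡ τ₂ → σ₁ ≡ σ₂

Alpha-functional zero α0 α0 _ = refl
Alpha-functional (suc zero) α1 α1 _ = refl
Alpha-functional (suc (suc k)) (αi σ _ _) (αi .σ _ _) refl = refl
Alpha-functional (suc (suc k)) (αi σ _ long) (αiiD .σ _ _ two _ _) refl = contradiction two long
Alpha-functional (suc (suc k)) (αi σ _ long) (αiiΠ .σ _ two _ _) refl = contradiction two long
Alpha-functional (suc (suc k)) (αiiD σ _ _ two _ _) (αi .σ _ long) refl = contradiction two long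
Alpha-functional (suc (suc k)) (αiiD σ _ _ _ a _) (αiiD .σ _ _ _ a′ _) refl =
  cong (f (suc k) (fromℕ (suc k))) (Alpha-injective (suc k) a a′ refl)
Alpha-functional (suc (suc k)) (αiiD σ _ _ _ a ρ∈D) (αiiΠ .σ _ _ 2∣k+2 a′) refl =
  contradiction (subst InD (Alpha-injective (suc k) a a′ refl) ρ∈D) (π-¬InD k (λ 2∣k+1 → 2∣⇒2∤suc (suc k) 2∣k+1 2∣k+2))
Alpha-functional (suc (suc k)) (αiiΠ σ _ two _ _) (αi .σ _ long) refl = contradiction two long
Alpha-functional (suc (suc k)) (αiiΠ σ _ _ 2∣k+2 a) (αiiD .σ _ _ _ a′ ρ′∈D) refl =
  contradiction (subst InD (Alpha-injective (suc k) a′ a refl) ρ′∈D) (π-¬InD k (λ 2∣k+1 → 2∣⇒2∤suc (suc k) 2∣k+1 2∣k+2))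
Alpha-functional (suc (suc k)) (αiiΠ σ _ _ _ _) (αiiΠ .σ _ _ _ _) refl = refl
Alpha-functional (suc (suc k)) (αiii _ _ a) (αiii _ _ a′) _ = cong (f (suc k) (fromℕ (suc k))) (Alpha-injective (suc k) a a′ refl)
Alpha-functional (suc (suc k)) (αi _ d _) (αiii _ 2∤k+2 _) eq = contradiction (subst InD eq d) (π-¬InD (suc k) 2∤k+2)
Alpha-functional (suc (suc k)) (αiiD _ _ d _ _ _) (αiii _ 2∤k+2 _) eq = contradiction (subst InD eq d) (π-¬InD (suc k) 2∤k+2)
Alpha-functional (suc (suc k)) (αiiΠ _ d _ _ _) (αiii _ 2∤k+2 _) eq = contradiction (subst InD eq d) (π-¬InD (suc k) 2∤k+2)
Alpha-functional (suc (suc k)) (αiii _ 2∤k+2 _) (αi _ d _) eq = contradiction (subst InD (sym eq) d) (π-¬InD (suc k) 2∤k+2)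
Alpha-functional (suc (suc k)) (αiii _ 2∤k+2 _) (αiiD _ _ d _ _ _) eq = contradiction (subst InD (sym eq) d) (π-¬InD (suc k) 2∤k+2)
Alpha-functional (suc (suc k)) (αiii _ 2∤k+2 _) (αiiΠ _ d _ _ _) eq = contradiction (subst InD (sym eq) d) (π-¬InD (suc k) 2∤k+2)

Alpha-injective zero α0 α0 _ = refl
Alpha-injective (suc zero) α1 α1 _ = refl
Alpha-injective (suc (suc k)) (αi σ d _) (αi σ′ d′ long′) eq =
  del-injective-at-last σ σ′ (proj₁ d) (proj₁ d′) same-last
    (f-injectiveʳ (lookup σ n) (del σ) (del σ′) (trans eq (cong (λ m → f (suc k) m (del σ′)) (sym same-last))))
  where
  n = fromℕ (suc k)
  same-last : lookup σ n ≡ lookup σ′ n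
  same-last = f-fixed-point-injective (del σ) (del σ′) (lookup σ n) (lookup σ′ n) (del-InD σ′ d′ long′) eq
Alpha-injective (suc (suc k)) (αi σ d _) (αiiD _ ρ′ _ _ _ ρ′∈D) eq =
  ⊥-elim (proj₂ d (fromℕ (suc k)) (f-fixed-point-injective (del σ) ρ′ (lookup σ (fromℕ (suc k))) (fromℕ (suc k)) ρ′∈D eq))
Alpha-injective (suc (suc k)) (αi σ d long) (αiiΠ _ _ _ 2∣k+2 _) eq =
  contradiction eq (f≢π-even (del σ) (lookup σ (fromℕ (suc k))) (del-InD σ d long) 2∣k+2)
Alpha-injective (suc (suc k)) (αi σ d _) (αiii ρ′ 2∤k+2 a′) eq =
  ⊥-elim (proj₂ d (fromℕ (suc k)) (f-fixed-point-injective (del σ) ρ′ (lookup σ (fromℕ (suc k))) (fromℕ (suc k))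
    (AlphaDom-odd⇒InD k 2∤k+2 (Alpha-dom a′)) eq))
Alpha-injective (suc (suc k)) (αiiD _ ρ _ _ _ _) (αi σ′ d′ long′) eq =
  ⊥-elim (proj₂ d′ (fromℕ (suc k)) (sym (f-fixed-point-injective ρ (del σ′) (fromℕ (suc k)) (lookup σ′ (fromℕ (suc k))) (del-InD σ′ d′ long′) eq)))
Alpha-injective (suc (suc k)) (αiiD σ ρ d two a _) (αiiD σ′ ρ′ d′ two′ a′ _) eq =
  del-injective-2-cycle σ σ′ d d′ two two′ (Alpha-functional (suc k) a a′ (f-injectiveʳ (fromℕ (suc k)) ρ ρ′ eq))
Alpha-injective (suc (suc k)) (αiiD _ ρ _ _ _ ρ∈D) (αiiΠ _ _ _ 2∣k+2 _) eq =
  contradiction eq (f≢π-even ρ (fromℕ (suc k)) ρ∈D 2∣k+2)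
Alpha-injective (suc (suc k)) (αiiD σ ρ d two a _) (αiii ρ′ 2∤k+2 a′) eq =
  ⊥-elim (InE⇒¬InD {τ = π (suc k)} (subst InE (Alpha-functional (suc k) a a′ (f-injectiveʳ (fromℕ (suc k)) ρ ρ′ eq)) (del-InE σ d two))
    (π-InD (suc k) (2∤suc⇒2∣ (suc k) 2∤k+2)))
Alpha-injective (suc (suc k)) (αiiΠ _ _ _ 2∣k+2 _) (αi σ′ d′ long′) eq =
  contradiction (sym eq) (f≢π-even (del σ′) (lookup σ′ (fromℕ (suc k))) (del-InD σ′ d′ long′) 2∣k+2)
Alpha-injective (suc (suc k)) (αiiΠ _ _ _ 2∣k+2 _) (αiiD _ ρ′ _ _ _ ρ′∈D) eq =
  contradiction (sym eq) (f≢π-even ρ′ (fromℕ (suc k)) ρ′∈D 2∣k+2)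
Alpha-injective (suc (suc k)) (αiiΠ σ d two _ a) (αiiΠ σ′ d′ two′ _ a′) _ =
  del-injective-2-cycle σ σ′ d d′ two two′ (Alpha-functional (suc k) a a′ refl)
Alpha-injective (suc (suc k)) (αiiΠ _ _ _ 2∣k+2 _) (αiii _ 2∤k+2 _) _ = contradiction 2∣k+2 2∤k+2
Alpha-injective (suc (suc k)) (αiii ρ _ _) (αi σ′ d′ long′) eq =
  ⊥-elim (proj₂ d′ (fromℕ (suc k)) (sym (f-fixed-point-injective ρ (del σ′) (fromℕ (suc k)) (lookup σ′ (fromℕ (suc k))) (del-InD σ′ d′ long′) eq)))
Alpha-injective (suc (suc k)) (αiii ρ 2∤k+2 a) (αiiD σ′ ρ′ d′ two′ a′ _) eq =
  ⊥-elim (InE⇒¬InD {τ = π (suc k)} (subst InE (Alpha-functional (suc k) a′ a (f-injectiveʳ (fromℕ (suc k)) ρ′ ρ (sym eq))) (del-InE σ′ d′ two′))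
    (π-InD (suc k) (2∤suc⇒2∣ (suc k) 2∤k+2)))
Alpha-injective (suc (suc k)) (αiii _ 2∤k+2 _) (αiiΠ _ _ _ 2∣k+2 _) _ = contradiction 2∣k+2 2∤k+2
Alpha-injective (suc (suc k)) (αiii _ _ _) (αiii _ _ _) _ = refl

Alpha-π : ∀ n → Alpha n (π n) (π n)
Alpha-π zero = α0
Alpha-π (suc zero) = α1
Alpha-π (suc (suc k)) = step (2 ∣? suc (suc k)) (Alpha-π (suc k))
  where
  step : Dec (2 ∣ suc (suc k)) → Alpha (suc k) (π (suc k)) (π (suc k)) → Alpha (suc (suc k)) (π (suc (suc k))) (π (suc (suc k)))
  step (yes 2∣k+2) a = αiiΠ (π (suc (suc k))) (π-InD _ 2∣k+2) (π-last-2-cycle k 2∣k+2) 2∣k+2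
                           (subst (Alpha (suc k) (π (suc k))) (sym (del-π k 2∣k+2)) a)
  step (no 2∤k+2) a = subst (Alpha (suc (suc k)) (π (suc (suc k)))) (f-last-π k 2∤k+2) (αiii (π (suc k)) 2∤k+2 a)

_∘⟨_⟩ : ∀ {k} → Perm (suc k) → Fin (suc k) → Perm (suc k)
_∘⟨_⟩ {k} τ a = tabulate (λ y → lookup τ (transpose (fromℕ k) a y))

module _ {k} (τ : Perm (suc k)) {a : Fin (suc k)} where

  lookup-∘⟨⟩ : ∀ y → lookup (τ ∘⟨ a ⟩) y ≡ lookup τ (transpose (fromℕ k) a y)
  lookup-∘⟨⟩ = lookup∘tabulate (λ y → lookup τ (transpose (fromℕ k) a y))

  ∘⟨⟩-last : lookup (τ ∘⟨ a ⟩) (fromℕ k) ≡ lookup τ a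
  ∘⟨⟩-last = trans (lookup-∘⟨⟩ (fromℕ k)) (cong (lookup τ) (transpose-ˡ (fromℕ k) a))

  ∘⟨⟩-self : a ≢ fromℕ k → lookup (τ ∘⟨ a ⟩) a ≡ lookup τ (fromℕ k)
  ∘⟨⟩-self a≢n = trans (lookup-∘⟨⟩ a) (cong (lookup τ) (transpose-ʳ a≢n))

  ∘⟨⟩-other : ∀ {y} → y ≢ fromℕ k → y ≢ a → lookup (τ ∘⟨ a ⟩) y ≡ lookup τ y
  ∘⟨⟩-other {y} y≢n y≢a = trans (lookup-∘⟨⟩ y) (cong (lookup τ) (transpose-other y≢n y≢a))

  ∘⟨⟩-IsPerm : a ≢ fromℕ k → IsPerm τ → IsPerm (τ ∘⟨ a ⟩)
  ∘⟨⟩-IsPerm a≢n τ-perm y z e =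
    transpose-injective a≢n y z (τ-perm _ _ (trans (sym (lookup-∘⟨⟩ y)) (trans e (lookup-∘⟨⟩ z))))

-- For τ ∈ E_n with fixed point m < n, case (i) of α applies to τ ∘ (m n) and gives back τ.
module _ {k} (τ : Perm (suc k)) (m : Fin k) (τ∈E : InE τ) (m-fixed : lookup τ (inject₁ m) ≡ inject₁ m) where

  private
    n = fromℕ k
    σ = τ ∘⟨ inject₁ m ⟩
    m≢n : inject₁ m ≢ n
    m≢n = inject₁≢fromℕ
    τ-perm = proj₁ τ∈E
    τn≢n : lookup τ n ≢ n
    τn≢n e = m≢n (InE-fixed-unique {τ = τ} τ∈E m-fixed e)
    σn≡m : lookup σ n ≡ inject₁ m
    σn≡m = trans (∘⟨⟩-last τ) m-fixed

  ∘⟨⟩-InD : InD σ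
  ∘⟨⟩-InD = ∘⟨⟩-IsPerm τ m≢n τ-perm , no-fixed
    where
    no-fixed : ∀ y → lookup σ y ≢ y
    no-fixed y e with y ≟ n
    ... | yes refl = m≢n (trans (sym σn≡m) e)
    ... | no y≢n with y ≟ inject₁ m
    ...   | yes refl = m≢n (sym (τ-perm _ _ (trans (sym (∘⟨⟩-self τ m≢n)) (trans e (sym m-fixed)))))
    ...   | no y≢m = y≢m (InE-fixed-unique {τ = τ} τ∈E (trans (sym (∘⟨⟩-other τ y≢n y≢m)) e) m-fixed)

  ∘⟨⟩-long-cycle : lookup σ (lookup σ n) ≢ n
  ∘⟨⟩-long-cycle e = τn≢n (trans (sym (∘⟨⟩-self τ m≢n)) (trans (cong (lookup σ) (sym σn≡m)) e))

  f-del-∘⟨⟩ : f k (lookup σ n) (del σ) ≡ τ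
  f-del-∘⟨⟩ = trans (cong (λ x → f k x (del σ)) σn≡m) (perm-ext agree)
    where
    agree : ∀ y → lookup (f k (inject₁ m) (del σ)) y ≡ lookup τ y
    agree y with fromℕ-or-inject₁ y
    ... | inj₁ refl with ≢fromℕ⇒inject₁ τn≢n
    ...   | w , τn≡w = trans (f-inject₁-last (del σ) m)
                             (trans (cong inject₁ (del-inject₁ σ m w (trans (∘⟨⟩-self τ m≢n) τn≡w))) (sym τn≡w))
    agree y | inj₂ (z , refl) with z ≟ m
    ... | yes refl = trans (f-inject₁-self (del σ) z) (sym m-fixed)
    ... | no z≢m with fromℕ-or-inject₁ (lookup τ (inject₁ z)) | ∘⟨⟩-other τ inject₁≢fromℕ (z≢m ∘ inject₁-injective)
    ...   | inj₁ τz≡n | σz≡τz =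
            trans (f-inject₁-pred (del σ) m z z≢m (del-bypass σ z m (trans σz≡τz τz≡n) σn≡m)) (sym τz≡n)
    ...   | inj₂ (v , τz≡v) | σz≡τz =
            trans (f-inject₁-other (del σ) m z z≢m del-σz≢m) (trans (cong inject₁ del-σz≡v) (sym τz≡v))
      where
      del-σz≡v : lookup (del σ) z ≡ v
      del-σz≡v = del-inject₁ σ z v (trans σz≡τz τz≡v)
      del-σz≢m : lookup (del σ) z ≢ m
      del-σz≢m e = z≢m (inject₁-injective (τ-perm _ _ (trans τz≡v (trans (cong inject₁ (trans (sym del-σz≡v) e)) (sym m-fixed)))))

Alpha-total-step : ∀ k → (∀ τ → InE τ → ∃ λ ρ → Alpha (suc k) ρ τ) →
                   ∀ σ → InD σ → ∃ λ τ → Alpha (suc (suc k)) σ τ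
Alpha-total-step k surjective σ σ∈D with lookup σ (lookup σ (fromℕ (suc k))) ≟ fromℕ (suc k)
... | no long = _ , αi σ σ∈D long
... | yes two with surjective (del σ) (del-InE σ σ∈D two)
...   | ρ , a with Alpha-dom a
...     | inj₁ ρ∈D = _ , αiiD σ ρ σ∈D two a ρ∈D
...     | inj₂ (2∤k+1 , refl) = _ , αiiΠ σ σ∈D two (2∤⇒2∣suc (suc k) 2∤k+1) a

Alpha-surjective-step : ∀ k → (∀ ρ → InD ρ → ∃ λ e → Alpha (suc k) ρ e) →
                        ∀ τ → InE τ → ∃ λ σ → Alpha (suc (suc k)) σ τ
Alpha-surjective-step k total τ τ∈E@(τ-perm , m , m-fixed , _) with fromℕ-or-inject₁ m
... | inj₂ (m′ , refl) =
      τ ∘⟨ inject₁ m′ ⟩ ,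
      subst (Alpha (suc (suc k)) (τ ∘⟨ inject₁ m′ ⟩)) (f-del-∘⟨⟩ τ m′ τ∈E m-fixed)
        (αi (τ ∘⟨ inject₁ m′ ⟩) (∘⟨⟩-InD τ m′ τ∈E m-fixed) (∘⟨⟩-long-cycle τ m′ τ∈E m-fixed))
Alpha-surjective-step k total τ τ∈E@(τ-perm , m , m-fixed , _) | inj₁ refl
  with total (del τ) (del-InD-fixed-last τ τ∈E m-fixed)
... | e , a with Alpha-cod a
...   | inj₁ e∈E@(_ , m″ , m″-fixed , _) =
        γ (suc k) m″ e ,
        subst (Alpha (suc (suc k)) (γ (suc k) m″ e)) (f-last-del τ τ-perm m-fixed)
          (αiiD (γ (suc k) m″ e) (del τ) (γ-InD m″ e e∈E m″-fixed) (γ-2-cycle m″ e)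
            (subst (Alpha (suc k) (del τ)) (sym (del-γ m″ e m″-fixed)) a) (del-InD-fixed-last τ τ∈E m-fixed))
...   | inj₂ (2∣k+1 , refl) =
        π (suc (suc k)) ,
        subst (Alpha (suc (suc k)) (π (suc (suc k)))) (f-last-del τ τ-perm m-fixed) (αiii (del τ) (2∣⇒2∤suc (suc k) 2∣k+1) a)

Alpha-total : ∀ n (σ : Perm n) → InD σ → ∃ λ τ → Alpha n σ τ
Alpha-surjective : ∀ n (τ : Perm n) → InE τ → ∃ λ σ → Alpha n σ τ

Alpha-total zero [] _ = [] , α0
Alpha-total (suc zero) (x ∷ []) (_ , no-fixed) = contradiction (Fin1-zero x) (no-fixed zero)
Alpha-total (suc (suc k)) = Alpha-total-step k (Alpha-surjective (suc k))

Alpha-surjective zero [] (_ , () , _)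
Alpha-surjective (suc zero) (x ∷ []) _ = π 1 , subst (Alpha 1 (π 1)) (cong (_∷ []) (sym (Fin1-zero x))) α1
Alpha-surjective (suc (suc k)) = Alpha-surjective-step k (Alpha-total (suc k))

Alpha-2-cycle-inverse : ∀ k {σ τ} → Alpha (suc (suc k)) σ τ → InD σ → lookup σ (lookup σ (fromℕ (suc k))) ≡ fromℕ (suc k) →
                        del σ ≢ π (suc k) → ∃ λ ρ → τ ≡ f (suc k) (fromℕ (suc k)) ρ × InD ρ × Alpha (suc k) ρ (del σ)
Alpha-2-cycle-inverse k (αi _ _ long) _ two _ = contradiction two long
Alpha-2-cycle-inverse k (αiiD _ ρ _ _ a ρ∈D) _ _ _ = ρ , refl , ρ∈D , a
Alpha-2-cycle-inverse k (αiiΠ _ _ _ _ a) _ _ del-σ≢π = contradiction (sym (Alpha-functional (suc k) (Alpha-π (suc k)) a refl)) del-σ≢π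
Alpha-2-cycle-inverse k (αiii _ 2∤k+2 _) π∈D _ _ = contradiction π∈D (π-¬InD (suc k) 2∤k+2)

-- The involution λ_n

Lam-functional : ∀ {n σ τ τ′} → Lam n σ τ → Lam n σ τ′ → τ ≡ τ′
Lam-functional {n} (λD _ _ _ a) (λD _ _ _ a′) = Alpha-functional n a a′ refl
Lam-functional {σ = σ} (λD _ _ σ∈D _) (λE _ _ _ σ∈E _ _) = contradiction σ∈D (InE⇒¬InD {τ = σ} σ∈E)
Lam-functional {σ = σ} (λE _ _ _ σ∈E _ _) (λD _ _ σ∈D _) = contradiction σ∈D (InE⇒¬InD {τ = σ} σ∈E)
Lam-functional {n} {σ} (λE _ m _ σ∈E m-fixed a) (λE _ m′ _ _ m′-fixed a′) =
  cong del (Alpha-functional (suc n) a a′ (cong (λ x → γ n x σ) (InE-fixed-unique {τ = σ} σ∈E m-fixed m′-fixed)))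

Lam-undoes-Alpha : ∀ {k ρ τ} → InD ρ → InE τ → Alpha (suc k) ρ τ → Lam (suc k) τ ρ
Lam-undoes-Alpha {k} {ρ} {τ} ρ∈D τ∈E@(_ , m , m-fixed , _) a =
  subst (Lam (suc k) τ) (del-f-last ρ)
    (λE τ m _ τ∈E m-fixed
      (αiiD (γ (suc k) m τ) ρ (γ-InD m τ τ∈E m-fixed) (γ-2-cycle m τ) (subst (Alpha (suc k) ρ) (sym (del-γ m τ m-fixed)) a) ρ∈D))

Lam-round-trip-D : ∀ {n} {σ : Perm (suc n)} → InD σ → σ ≢ π (suc n) → ∃ λ τ → InE τ × Lam (suc n) σ τ × Lam (suc n) τ σ
Lam-round-trip-D {n} {σ} σ∈D σ≢π with Alpha-total (suc n) σ σ∈D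
... | τ , a with Alpha-cod a
...   | inj₁ τ∈E = τ , τ∈E , λD σ τ σ∈D a , Lam-undoes-Alpha σ∈D τ∈E a
...   | inj₂ (_ , refl) = contradiction (Alpha-injective (suc n) a (Alpha-π (suc n)) refl) σ≢π

Lam-round-trip-E : ∀ {n} {σ : Perm (suc n)} → InE σ → σ ≢ π (suc n) → ∃ λ τ → InD τ × Lam (suc n) σ τ × Lam (suc n) τ σ
Lam-round-trip-E {n} {σ} σ∈E@(_ , m , m-fixed , _) σ≢π with Alpha-total (suc (suc n)) (γ (suc n) m σ) (γ-InD m σ σ∈E m-fixed)
... | τ′ , a with Alpha-2-cycle-inverse n a (γ-InD m σ σ∈E m-fixed) (γ-2-cycle m σ) (σ≢π ∘ trans (sym (del-γ m σ m-fixed)))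
...   | τ , refl , τ∈D , a′ =
        τ , τ∈D , subst (Lam (suc n) σ) (del-f-last τ) (λE σ m _ σ∈E m-fixed a) ,
        λD τ σ τ∈D (subst (Alpha (suc n) τ) (del-γ m σ m-fixed) a′)

theorem2 : ∀ (n : ℕ) → n ≥ 1 → (σ : Perm n) → (InD σ ⊎ InE σ) → σ ≢ π n →
    ∃ (λ τ → Lam n σ τ × (∀ τ' → Lam n σ τ' → τ' ≡ τ)
      × (InD σ → InE τ) × (InE σ → InD τ)
      × Lam n τ σ × (∀ σ' → Lam n τ σ' → σ' ≡ σ))
theorem2 zero () _ _ _
theorem2 (suc n) _ σ (inj₁ σ∈D) σ≢π with Lam-round-trip-D σ∈D σ≢π
... | τ , τ∈E , σ↦τ , τ↦σ =
      τ , σ↦τ , (λ _ l → Lam-functional l σ↦τ) , (λ _ → τ∈E) , (λ σ∈E → contradiction σ∈D (InE⇒¬InD {τ = σ} σ∈E)) ,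
      τ↦σ , (λ _ l → Lam-functional l τ↦σ)
theorem2 (suc n) _ σ (inj₂ σ∈E) σ≢π with Lam-round-trip-E σ∈E σ≢π
... | τ , τ∈D , σ↦τ , τ↦σ =
      τ , σ↦τ , (λ _ l → Lam-functional l σ↦τ) , (λ σ∈D → contradiction σ∈D (InE⇒¬InD {τ = σ} σ∈E)) , (λ _ → τ∈D) ,
      τ↦σ , (λ _ l → Lam-functional l τ↦σ)
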